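{- Fix $k\geq 2$ and let $c,d\in\mathbb N$. Then (1) $c\leq c[k\leftarrow k+1]$; and (2) if $c<d$, then $c[k\leftarrow k+1]<d[k\leftarrow k+1]$.
   Context: For $a,b\in\mathbb N$ and $k\geq2$ define $A_a(k,b)$ by: $A_0(k,b)=k^b$; $A_{a+1}(k,0)=A_a^k(k,\cdot)(0)$; $A_{a+1}(k,b+1)=A_a^k(k,\cdot)(A_{a+1}(k,b))$, where $A_a^k(k,\cdot)$ denotes the $k$-fold composition of $x\mapsto A_a(k,x)$. For every $c>0$ there are unique $a,b,m,n\in\mathbb N$ such that $c=A_a(k,b)\cdot m+n$, $A_a(k,0)\leq c<A_{a+1}(k,0)$, $A_a(k,b)\leq c<A_a(k,b+1)$ and $n<A_a(k,b)$; this is the $k$-normal form of $c$, written $c=_{\rm NF}A_a(k,b)\cdot m+n$. The base change is defined recursively by $0[k\leftarrow k+1]=0$ and, if $c=_{\rm NF}A_a(k,b)\cdot m+n$, $c[k\leftarrow k+1]=A_a(k+1,b[k\leftarrow k+1])\cdot m+n[k\leftarrow k+1]$. -}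

module Defs where

open import Data.Nat using (ℕ; zero; suc; _+_; _*_; _^_; _≤_; _<_; _≤ᵇ_)
open import Data.Nat.DivMod using (_/_; _%_)
open import Data.Bool using (Bool; true; false; if_then_else_)
open import Data.Product using (_×_; _,_)
open import Relation.Binary.PropositionalEquality using (_≡_)

iter : ℕ → (ℕ → ℕ) → ℕ → ℕ
iter zero    f x = x
iter (suc i) f x = f (iter i f x)

Ack : ℕ → ℕ → ℕ → ℕ
Ack zero    k b       = k ^ b
Ack (suc a) k zero    = iter k (Ack a k) 0
Ack (suc a) k (suc b) = iter k (Ack a k) (Ack (suc a) k b)

-- greatest i ≤ N with P i (0 if none)
findLast : (ℕ → Bool) → ℕ → ℕ
findLast P zero    = zero
findLast P (suc N) = if P (suc N) then suc N else findLast P N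

-- Computation of the normal form of c > 0.  Since A_a(k,0) and A_a(k,b) are
-- strictly increasing in a resp. b and exceed a resp. b, the unique a (resp. b)
-- of the normal form is the greatest a ≤ c with A_a(k,0) ≤ c (resp. the greatest
-- b ≤ c with A_a(k,b) ≤ c); then m = c div A_a(k,b), n = c mod A_a(k,b).
nfA : ℕ → ℕ → ℕ
nfA k c = findLast (λ a → Ack a k 0 ≤ᵇ c) c

nfB : ℕ → ℕ → ℕ
nfB k c = findLast (λ b → Ack (nfA k c) k b ≤ᵇ c) c

quot : ℕ → ℕ → ℕ
quot c zero    = zero
quot c (suc d) = c / suc d

remd : ℕ → ℕ → ℕ
remd c zero    = c
remd c (suc d) = c % suc d

nfM : ℕ → ℕ → ℕ
nfM k c = quot c (Ack (nfA k c) k (nfB k c))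

nfN : ℕ → ℕ → ℕ
nfN k c = remd c (Ack (nfA k c) k (nfB k c))

-- base change with fuel (fuel c suffices since b < c and n < c in the normal form)
bcFuel : ℕ → ℕ → ℕ → ℕ
bcFuel k zero    c       = zero
bcFuel k (suc f) zero    = zero
bcFuel k (suc f) (suc c) =
  Ack (nfA k (suc c)) (suc k) (bcFuel k f (nfB k (suc c))) * nfM k (suc c)
    + bcFuel k f (nfN k (suc c))

baseChange : ℕ → ℕ → ℕ
baseChange k c = bcFuel k c c

module Submission where

-- Write f = baseChange k. One shows f c < f (c + 1) by strong induction on c; then
-- f is strictly increasing, and c ≤ f c follows. For c = A_a(k,b)·m + n in normal
-- form, f c = A_a(k+1, f b)·m + f n, and f n < f (A_a(k,b)) = A_a(k+1, f b) by the
-- induction hypothesis. If c + 1 has the same a and b, its normal form differs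
-- from that of c only in the last digit (n ↦ n + 1, or m ↦ m + 1 with remainder 0).
-- Otherwise c + 1 starts a new exponent or a new level, and f (c + 1) = A_a(k+1, t)
-- with t > f b; it then suffices that A_a(k+1, B)·(m + 1) ≤ A_a(k+1, B + 1) for
-- B ≥ b. For a = 0 this is m < k. For a > 0, A_a(k+1, B + 1) = A_{a-1}(k+1, z) with
-- z ≥ A_a(k+1, B) and z > m, and A_{a-1}(k+1, z) ≥ 3^z ≥ z².

open import Defs
open import Data.Nat using (ℕ; zero; suc; _+_; _*_; _^_; _≤_; _<_; _≤ᵇ_; z≤n; s≤s; >-nonZero)
open import Data.Nat.Properties
open import Data.Nat.DivMod using (m≡m%n+[m/n]*n; m%n<n; +-distrib-/-∣ʳ; m<n⇒m/n≡0; m*n/n≡m; [m+kn]%n≡m%n; m<n⇒m%n≡m)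
open import Data.Nat.Divisibility using (divides)
open import Data.Nat.Induction using (<-rec)
open import Data.Nat.Solver using (module +-*-Solver)
open import Data.Bool using (Bool; true; false; T)
open import Data.Unit using (tt)
open import Data.Product using (_×_; _,_; proj₁; proj₂)
open import Data.Sum using (inj₁; inj₂)
open import Function using (_∘_)
open import Relation.Binary.Core using (_Preserves_⟶_)
open import Relation.Nullary using (¬_; yes; no; contradiction)
open import Relation.Binary.PropositionalEquality using (_≡_; refl; sym; trans; cong; cong₂; subst)

Inflationary : (ℕ → ℕ) → Set
Inflationary g = ∀ x → x < g x

module _ {g : ℕ → ℕ} where

  step-<⇒mono-< : (∀ x → g x < g (suc x)) → g Preserves _<_ ⟶ _<_
  step-<⇒mono-< step {x} {suc y} (s≤s x≤y) with m≤n⇒m<n∨m≡n x≤y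
  ... | inj₁ x<y  = <-trans (step-<⇒mono-< step x<y) (step y)
  ... | inj₂ refl = step y

  step-<⇒≥id : (∀ x → g x < g (suc x)) → ∀ x → x ≤ g x
  step-<⇒≥id step zero    = z≤n
  step-<⇒≥id step (suc x) = ≤-trans (s≤s (step-<⇒≥id step x)) (step x)

  mono-<⇒mono-≤ : g Preserves _<_ ⟶ _<_ → g Preserves _≤_ ⟶ _≤_
  mono-<⇒mono-≤ mono x≤y with m≤n⇒m<n∨m≡n x≤y
  ... | inj₁ x<y  = <⇒≤ (mono x<y)
  ... | inj₂ refl = ≤-refl

  mono-≤⇒reflects-< : g Preserves _≤_ ⟶ _≤_ → ∀ {x y} → g x < g y → x < y
  mono-≤⇒reflects-< mono {x} {y} gx<gy with x <? y
  ... | yes x<y = x<y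
  ... | no  x≮y = contradiction (mono (≮⇒≥ x≮y)) (<⇒≱ gx<gy)

module _ {g : ℕ → ℕ} (infl : Inflationary g) where

  iter-≥ : ∀ i x → x ≤ iter i g x
  iter-≥ zero    x = ≤-refl
  iter-≥ (suc i) x = ≤-trans (iter-≥ i x) (<⇒≤ (infl _))

  iter-suc-> : ∀ i x → x < iter (suc i) g x
  iter-suc-> i x = ≤-<-trans (iter-≥ i x) (infl _)

  iter-monoˡ-< : ∀ x → (λ i → iter i g x) Preserves _<_ ⟶ _<_
  iter-monoˡ-< x = step-<⇒mono-< (λ i → infl (iter i g x))

iter-mono-≤ : ∀ {g h} → (∀ x → g x ≤ h x) → h Preserves _≤_ ⟶ _≤_ →
              ∀ i {x y} → x ≤ y → iter i g x ≤ iter i h y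
iter-mono-≤ g≤h mono zero    x≤y = x≤y
iter-mono-≤ g≤h mono (suc i) x≤y = ≤-trans (g≤h _) (mono (iter-mono-≤ g≤h mono i x≤y))

FloorOf : (ℕ → ℕ) → ℕ → ℕ → Set
FloorOf F c t = F t ≤ c × c < F (suc t)

module _ (P : ℕ → Bool) where

  findLast-satisfies : T (P 0) → ∀ N → T (P (findLast P N))
  findLast-satisfies P0 zero    = P0
  findLast-satisfies P0 (suc N) with P (suc N) in eq
  ... | true  = subst T (sym eq) tt
  ... | false = findLast-satisfies P0 N

  findLast-maximal : ∀ N {i} → findLast P N < i → i ≤ N → ¬ T (P i)
  findLast-maximal zero    r<i i≤N = contradiction i≤N (<⇒≱ r<i)
  findLast-maximal (suc N) r<i i≤N Pi with P (suc N) in eq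
  ... | true  = contradiction i≤N (<⇒≱ r<i)
  ... | false with m≤n⇒m<n∨m≡n i≤N
  ...   | inj₁ i<N  = findLast-maximal N r<i (≤-pred i<N) Pi
  ...   | inj₂ refl = subst T eq Pi

findLast-floorOf : ∀ {F c} → Inflationary F → F 0 ≤ c → FloorOf F c (findLast (λ x → F x ≤ᵇ c) c)
findLast-floorOf {F} {c} infl F0≤c = ≤ᵇ⇒≤ _ _ (findLast-satisfies P (≤⇒≤ᵇ F0≤c) c) , c<F[t+1]
  where
  P : ℕ → Bool
  P x = F x ≤ᵇ c
  c<F[t+1] : c < F (suc (findLast P c))
  c<F[t+1] with suc (findLast P c) ≤? c
  ... | yes t<c = ≰⇒> (findLast-maximal P c ≤-refl t<c ∘ ≤⇒≤ᵇ)
  ... | no  t≮c = <-trans (≰⇒> t≮c) (infl _)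

floorOf-unique : ∀ {F c s t} → F Preserves _≤_ ⟶ _≤_ → FloorOf F c s → FloorOf F c t → s ≡ t
floorOf-unique {F} {c} mono (Fs≤c , c<Fs+1) (Ft≤c , c<Ft+1) =
  ≤-antisym (below Fs≤c c<Ft+1) (below Ft≤c c<Fs+1)
  where
  below : ∀ {x y} → F x ≤ c → c < F (suc y) → x ≤ y
  below Fx≤c c<Fy+1 = ≤-pred (mono-≤⇒reflects-< mono (≤-<-trans Fx≤c c<Fy+1))

quot-remd-unique : ∀ {x d q r} → r < d → x ≡ r + q * d → quot x d ≡ q × remd x d ≡ r
quot-remd-unique {d = suc d} {q} {r} r<d refl =
    trans (+-distrib-/-∣ʳ r (divides q refl)) (cong₂ _+_ (m<n⇒m/n≡0 r<d) (m*n/n≡m q (suc d)))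
  , trans ([m+kn]%n≡m%n r q (suc d)) (m<n⇒m%n≡m r<d)

remd+quot* : ∀ x d → 0 < d → x ≡ remd x d + quot x d * d
remd+quot* x (suc d) _ = m≡m%n+[m/n]*n x (suc d)

remd< : ∀ x d → 0 < d → remd x d < d
remd< x (suc d) _ = m%n<n x (suc d)

n<m^n : ∀ {m} → 1 < m → ∀ n → n < m ^ n
n<m^n     1<m zero    = s≤s z≤n
n<m^n {m} 1<m (suc n) = ≤-<-trans (n<m^n 1<m n) (^-monoʳ-< m 1<m (n<1+n n))

n*n≤3^n : ∀ n → n * n ≤ 3 ^ n
n*n≤3^n zero    = z≤n
n*n≤3^n (suc n) = begin
  suc n * suc n             ≡⟨ solve 1 (λ n → (con 1 :+ n) :* (con 1 :+ n) := n :* n :+ ((con 1 :+ n) :+ n)) refl n ⟩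
  n * n + (suc n + n)       ≤⟨ +-mono-≤ (n*n≤3^n n) (+-monoʳ-≤ (suc n) (n≤1+n n)) ⟩
  3 ^ n + (suc n + suc n)   ≤⟨ +-monoʳ-≤ (3 ^ n) (+-mono-≤ n<3^n n<3^n) ⟩
  3 ^ n + (3 ^ n + 3 ^ n)   ≡⟨ solve 1 (λ x → x :+ (x :+ x) := con 3 :* x) refl (3 ^ n) ⟩
  3 * 3 ^ n                 ∎
  where
  open ≤-Reasoning
  open +-*-Solver
  n<3^n : n < 3 ^ n
  n<3^n = n<m^n (s≤s (s≤s z≤n)) n

module Ackermann (j : ℕ) where

  k : ℕ
  k = suc (suc j)

  1<k : 1 < k
  1<k = s≤s (s≤s z≤n)

  Ack-inflationary : ∀ a → Inflationary (Ack a k)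
  Ack-inflationary zero          = n<m^n 1<k
  Ack-inflationary (suc a) zero    = iter-suc-> (Ack-inflationary a) (suc j) 0
  Ack-inflationary (suc a) (suc b) =
    <-≤-trans (s≤s (Ack-inflationary (suc a) b)) (iter-suc-> (Ack-inflationary a) (suc j) _)

  Ack-positive : ∀ a b → 0 < Ack a k b
  Ack-positive a b = ≤-<-trans z≤n (Ack-inflationary a b)

  Ack-suc : ∀ a b → Ack a k b < Ack a k (suc b)
  Ack-suc zero    b = ^-monoʳ-< k 1<k (n<1+n b)
  Ack-suc (suc a) b = iter-suc-> (Ack-inflationary a) (suc j) _

  Ack-monoʳ-< : ∀ a → Ack a k Preserves _<_ ⟶ _<_
  Ack-monoʳ-< a = step-<⇒mono-< (Ack-suc a)

  Ack-monoʳ-≤ : ∀ a → Ack a k Preserves _≤_ ⟶ _≤_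
  Ack-monoʳ-≤ a = mono-<⇒mono-≤ (Ack-monoʳ-< a)

  Ack-suc-level : ∀ a → Ack a k 0 < Ack (suc a) k 0
  Ack-suc-level a = Ack-monoʳ-< a (iter-suc-> (Ack-inflationary a) j 0)

  Ack-level-monoˡ-≤ : (λ a → Ack a k 0) Preserves _≤_ ⟶ _≤_
  Ack-level-monoˡ-≤ = mono-<⇒mono-≤ (step-<⇒mono-< Ack-suc-level)

  Ack-level-inflationary : Inflationary (λ a → Ack a k 0)
  Ack-level-inflationary zero    = s≤s z≤n
  Ack-level-inflationary (suc a) = <-≤-trans (s≤s (Ack-level-inflationary a)) (Ack-suc-level a)

  k^≤Ack : ∀ a b → k ^ b ≤ Ack a k b
  k^≤Ack zero    b       = ≤-refl
  k^≤Ack (suc a) zero    = Ack-inflationary (suc a) 0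
  k^≤Ack (suc a) (suc b) = begin
    k ^ suc b                         ≤⟨ ^-monoʳ-≤ k (Ack-inflationary (suc a) b) ⟩
    k ^ y                             ≤⟨ k^≤Ack a y ⟩
    Ack a k y                         ≤⟨ Ack-monoʳ-≤ a (iter-≥ (Ack-inflationary a) (suc j) y) ⟩
    Ack a k (iter (suc j) (Ack a k) y) ∎
    where
    open ≤-Reasoning
    y = Ack (suc a) k b

Ack-base-≤ : ∀ j a b → Ack a (suc (suc j)) b ≤ Ack a (suc (suc (suc j))) b
Ack-base-≤ j zero    b       = ^-monoˡ-≤ b (n≤1+n _)
Ack-base-≤ j (suc a) zero    =
  ≤-trans (iter-mono-≤ (Ack-base-≤ j a) (Ackermann.Ack-monoʳ-≤ (suc j) a) (suc (suc j)) z≤n)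
          (<⇒≤ (Ackermann.Ack-inflationary (suc j) a _))
Ack-base-≤ j (suc a) (suc b) =
  ≤-trans (iter-mono-≤ (Ack-base-≤ j a) (Ackermann.Ack-monoʳ-≤ (suc j) a) (suc (suc j)) (Ack-base-≤ j (suc a) b))
          (<⇒≤ (Ackermann.Ack-inflationary (suc j) a _))

module BaseChange (j : ℕ) where

  open Ackermann j
  module Next = Ackermann (suc j)

  Ack-absorbs-multiplier : ∀ a {b B m} → b ≤ B → Ack a k b * m < Ack a k (suc b) →
                           Ack a (suc k) B * suc m ≤ Ack a (suc k) (suc B)
  Ack-absorbs-multiplier zero {b} {B} {m} _ k^b*m<k^b+1 = begin
    suc k ^ B * suc m ≤⟨ *-monoʳ-≤ (suc k ^ B) (m≤n⇒m≤1+n m<k) ⟩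
    suc k ^ B * suc k ≡⟨ *-comm (suc k ^ B) (suc k) ⟩
    suc k ^ suc B     ∎
    where
    open ≤-Reasoning
    m<k : m < k
    m<k = *-cancelʳ-< (k ^ b) m k (subst (_< k ^ suc b) (*-comm (k ^ b) m) k^b*m<k^b+1)
  Ack-absorbs-multiplier (suc a) {b} {B} {m} b≤B Ab*m<Ab+1 = begin
    x * suc m ≤⟨ *-mono-≤ (iter-≥ (Next.Ack-inflationary a) k x) m<z ⟩
    z * z     ≤⟨ n*n≤3^n z ⟩
    3 ^ z     ≤⟨ ^-monoˡ-≤ z (s≤s (s≤s (s≤s z≤n))) ⟩
    suc k ^ z ≤⟨ Next.k^≤Ack a z ⟩
    Ack a (suc k) z ∎
    where
    open ≤-Reasoning
    x = Ack (suc a) (suc k) B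
    z = iter k (Ack a (suc k)) x
    m≤Ab*m : m ≤ Ack (suc a) k b * m
    m≤Ab*m = m≤n*m m _ {{>-nonZero (Ack-positive (suc a) b)}}
    m<z : m < z
    m<z = ≤-<-trans m≤Ab*m (<-≤-trans Ab*m<Ab+1
            (iter-mono-≤ (Ack-base-≤ j a) (Next.Ack-monoʳ-≤ a) k
              (≤-trans (Ack-monoʳ-≤ (suc a) b≤B) (Ack-base-≤ j (suc a) B))))

  record IsNF (c a b : ℕ) : Set where
    constructor isNF
    field
      level-floorOf    : FloorOf (λ a → Ack a k 0) c a
      exponent-floorOf : FloorOf (Ack a k) c b

  open IsNF

  IsNF-positive : ∀ {c a b} → IsNF c a b → 0 < c
  IsNF-positive {a = a} (isNF (a-lower , _) _) = <-≤-trans (Ack-positive a 0) a-lower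

  nf-isNF : ∀ c → 0 < c → IsNF c (nfA k c) (nfB k c)
  nf-isNF c 0<c = isNF floorA (findLast-floorOf (Ack-inflationary (nfA k c)) (proj₁ floorA))
    where
    floorA = findLast-floorOf Ack-level-inflationary 0<c

  nf-unique : ∀ {c a b} → IsNF c a b → nfA k c ≡ a × nfB k c ≡ b
  nf-unique {c} {a} {b} nf@(isNF floorA floorB) = a≡ , floorOf-unique (Ack-monoʳ-≤ a) floorB′ floorB
    where
    computed = nf-isNF c (IsNF-positive nf)
    a≡ = floorOf-unique Ack-level-monoˡ-≤ (level-floorOf computed) floorA
    floorB′ = subst (λ a′ → FloorOf (Ack a′ k) c (nfB k c)) a≡ (exponent-floorOf computed)

  nfB< : ∀ c → 0 < c → nfB k c < c
  nfB< c 0<c = <-≤-trans (Ack-inflationary (nfA k c) (nfB k c)) (proj₁ (exponent-floorOf (nf-isNF c 0<c)))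

  nfN< : ∀ c → 0 < c → nfN k c < c
  nfN< c 0<c = <-≤-trans (remd< c _ (Ack-positive (nfA k c) (nfB k c))) (proj₁ (exponent-floorOf (nf-isNF c 0<c)))

  bcFuel-zero : ∀ fuel → bcFuel k fuel 0 ≡ 0
  bcFuel-zero zero    = refl
  bcFuel-zero (suc _) = refl

  bcFuel-irrelevant : ∀ {fuel fuel′} x → x ≤ fuel → x ≤ fuel′ → bcFuel k fuel x ≡ bcFuel k fuel′ x
  bcFuel-irrelevant {fuel} {fuel′} zero _ _ = trans (bcFuel-zero fuel) (sym (bcFuel-zero fuel′))
  bcFuel-irrelevant {suc _} {suc _} (suc x) (s≤s x≤f) (s≤s x≤f′) =
    cong₂ (λ u v → Ack (nfA k (suc x)) (suc k) u * nfM k (suc x) + v)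
      (bcFuel-irrelevant _ (≤-trans b≤x x≤f) (≤-trans b≤x x≤f′))
      (bcFuel-irrelevant _ (≤-trans n≤x x≤f) (≤-trans n≤x x≤f′))
    where
    b≤x = ≤-pred (nfB< (suc x) (s≤s z≤n))
    n≤x = ≤-pred (nfN< (suc x) (s≤s z≤n))

  f : ℕ → ℕ
  f = baseChange k

  f-suc : ∀ c → f (suc c) ≡ Ack (nfA k (suc c)) (suc k) (f (nfB k (suc c))) * nfM k (suc c) + f (nfN k (suc c))
  f-suc c = cong₂ (λ u v → Ack (nfA k (suc c)) (suc k) u * nfM k (suc c) + v)
    (bcFuel-irrelevant _ (≤-pred (nfB< (suc c) (s≤s z≤n))) ≤-refl)
    (bcFuel-irrelevant _ (≤-pred (nfN< (suc c) (s≤s z≤n))) ≤-refl)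

  f-nf : ∀ {x a b q r} → IsNF x a b → r < Ack a k b → x ≡ r + q * Ack a k b →
         f x ≡ Ack a (suc k) (f b) * q + f r
  f-nf {zero} nf _ _ = contradiction (IsNF-positive nf) (λ ())
  f-nf {suc x} {a} {b} {q} {r} nf r<A x≡ =
    trans (f-suc x) (cong₂ _+_ (cong₂ _*_ (cong₂ (λ a b → Ack a (suc k) (f b)) a≡ b≡) m≡) (cong f n≡))
    where
    a≡ = proj₁ (nf-unique nf)
    b≡ = proj₂ (nf-unique nf)
    A≡ : Ack (nfA k (suc x)) k (nfB k (suc x)) ≡ Ack a k b
    A≡ = cong₂ (λ a b → Ack a k b) a≡ b≡
    m≡ : nfM k (suc x) ≡ q
    m≡ = trans (cong (quot (suc x)) A≡) (proj₁ (quot-remd-unique {q = q} r<A x≡))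
    n≡ : nfN k (suc x) ≡ r
    n≡ = trans (cong (remd (suc x)) A≡) (proj₂ (quot-remd-unique {q = q} r<A x≡))

  f-Ack : ∀ a b → Ack a k b < Ack (suc a) k 0 → f (Ack a k b) ≡ Ack a (suc k) (f b)
  f-Ack a b A<next = trans (f-nf nf (Ack-positive a b) (sym (+-identityʳ _))) (trans (+-identityʳ _) (*-identityʳ _))
    where
    nf : IsNF (Ack a k b) a b
    nf = isNF (Ack-monoʳ-≤ a z≤n , A<next) (≤-refl , Ack-suc a b)

  f-iter : ∀ a i → i < k → f (iter i (Ack a k) 0) ≡ iter i (Ack a (suc k)) 0
  f-iter a zero    _   = refl
  f-iter a (suc i) i<k =
    trans (f-Ack a _ (iter-monoˡ-< (Ack-inflationary a) 0 i<k)) (cong (Ack a (suc k)) (f-iter a i (<-trans (n<1+n i) i<k)))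

  record NF (c : ℕ) : Set where
    field
      a b m n : ℕ
      bounds  : IsNF c a b
      n<A     : n < Ack a k b
      c≡      : c ≡ n + m * Ack a k b

  normalForm : ∀ c → 0 < c → NF c
  normalForm c 0<c = record
    { a      = nfA k c
    ; b      = nfB k c
    ; m      = nfM k c
    ; n      = nfN k c
    ; bounds = nf-isNF c 0<c
    ; n<A    = remd< c _ (Ack-positive (nfA k c) (nfB k c))
    ; c≡     = remd+quot* c _ (Ack-positive (nfA k c) (nfB k c))
    }

  module InductionStep {c : ℕ} (ih : ∀ {x} → x < c → f x < f (suc x)) (nf : NF c) where

    open NF nf

    f-mono-< : ∀ {x y} → x < y → y ≤ c → f x < f y
    f-mono-< {x} {suc y} (s≤s x≤y) y<c with m≤n⇒m<n∨m≡n x≤y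
    ... | inj₁ x<y  = <-trans (f-mono-< x<y (<⇒≤ y<c)) (ih y<c)
    ... | inj₂ refl = ih y<c

    f-≥ : ∀ {x} → x ≤ c → x ≤ f x
    f-≥ {zero}  _   = z≤n
    f-≥ {suc x} x<c = ≤-trans (s≤s (f-≥ (<⇒≤ x<c))) (ih x<c)

    A = Ack a k b
    A′ = Ack a (suc k) (f b)

    a-lower = proj₁ (level-floorOf bounds)
    a-upper = proj₂ (level-floorOf bounds)
    b-lower = proj₁ (exponent-floorOf bounds)
    b-upper = proj₂ (exponent-floorOf bounds)

    b<c : b < c
    b<c = <-≤-trans (Ack-inflationary a b) b-lower

    n<c : n < c
    n<c = <-≤-trans n<A b-lower

    A*m≤c : A * m ≤ c
    A*m≤c = ≤-trans (≤-reflexive (*-comm A m)) (≤-trans (m≤n+m (m * A) n) (≤-reflexive (sym c≡)))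

    f-c<A′*[m+1] : f c < A′ * suc m
    f-c<A′*[m+1] = begin-strict
      f c           ≡⟨ f-nf bounds n<A c≡ ⟩
      A′ * m + f n  <⟨ +-monoʳ-< (A′ * m) (subst (f n <_) (f-Ack a b (≤-<-trans b-lower a-upper)) (f-mono-< n<A b-lower)) ⟩
      A′ * m + A′   ≡⟨ +-comm (A′ * m) A′ ⟩
      A′ + A′ * m   ≡⟨ *-suc A′ m ⟨
      A′ * suc m    ∎
      where open ≤-Reasoning

    f-suc-c-> : ∀ t → f (suc c) ≡ Ack a (suc k) t → suc (f b) ≤ t → f c < f (suc c)
    f-suc-c-> t f-c+1≡ fb<t = <-≤-trans f-c<A′*[m+1] (begin
      A′ * suc m                  ≤⟨ Ack-absorbs-multiplier a (f-≥ (<⇒≤ b<c)) (≤-<-trans A*m≤c b-upper) ⟩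
      Ack a (suc k) (suc (f b))  ≤⟨ Next.Ack-monoʳ-≤ a fb<t ⟩
      Ack a (suc k) t            ≡⟨ f-c+1≡ ⟨
      f (suc c)                  ∎)
      where open ≤-Reasoning

    new-level : suc c ≡ Ack (suc a) k 0 → f c < f (suc c)
    new-level c+1≡ = f-suc-c-> (iter k G 0) f-c+1≡ (<-trans f-b<f-w (Next.Ack-inflationary a _))
      where
      G = Ack a (suc k)
      w = iter (suc j) (Ack a k) 0
      f-c+1≡ : f (suc c) ≡ G (iter k G 0)
      f-c+1≡ = trans (cong f c+1≡) (f-Ack (suc a) 0 (Ack-suc-level (suc a)))
      b<w : b < w
      b<w = mono-≤⇒reflects-< (Ack-monoʳ-≤ a) (≤-trans (s≤s b-lower) (≤-reflexive c+1≡))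
      w≤c : w ≤ c
      w≤c = ≤-pred (≤-trans (Ack-inflationary a w) (≤-reflexive (sym c+1≡)))
      f-b<f-w : f b < iter (suc j) G 0
      f-b<f-w = subst (f b <_) (f-iter a (suc j) ≤-refl) (f-mono-< b<w w≤c)

    new-exponent : suc c ≡ Ack a k (suc b) → suc c < Ack (suc a) k 0 → f c < f (suc c)
    new-exponent c+1≡ c+1<next = f-suc-c-> (f (suc b)) f-c+1≡ (ih b<c)
      where
      f-c+1≡ : f (suc c) ≡ Ack a (suc k) (f (suc b))
      f-c+1≡ = trans (cong f c+1≡) (f-Ack a (suc b) (subst (_< Ack (suc a) k 0) c+1≡ c+1<next))

    same-a-b : suc c < Ack (suc a) k 0 → suc c < Ack a k (suc b) → IsNF (suc c) a b
    same-a-b c+1<next c+1<A[b+1] = isNF (m≤n⇒m≤1+n a-lower , c+1<next) (m≤n⇒m≤1+n b-lower , c+1<A[b+1])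

    next-remainder : IsNF (suc c) a b → suc n < A → f c < f (suc c)
    next-remainder nf′ n+1<A = begin-strict
      f c               ≡⟨ f-nf bounds n<A c≡ ⟩
      A′ * m + f n      <⟨ +-monoʳ-< (A′ * m) (ih n<c) ⟩
      A′ * m + f (suc n) ≡⟨ f-nf nf′ n+1<A (cong suc c≡) ⟨
      f (suc c)         ∎
      where open ≤-Reasoning

    carry : IsNF (suc c) a b → suc n ≡ A → f c < f (suc c)
    carry nf′ n+1≡A = <-≤-trans f-c<A′*[m+1] (≤-reflexive (sym f-c+1≡))
      where
      f-c+1≡ : f (suc c) ≡ A′ * suc m
      f-c+1≡ = trans (f-nf nf′ (Ack-positive a b) (trans (cong suc c≡) (cong (_+ m * A) n+1≡A))) (+-identityʳ _)

    f-suc-> : f c < f (suc c)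
    f-suc-> with m≤n⇒m<n∨m≡n a-upper
    ... | inj₂ c+1≡ = new-level c+1≡
    ... | inj₁ c+1<next with m≤n⇒m<n∨m≡n b-upper
    ...   | inj₂ c+1≡ = new-exponent c+1≡ c+1<next
    ...   | inj₁ c+1<A[b+1] with m≤n⇒m<n∨m≡n n<A
    ...     | inj₁ n+1<A = next-remainder (same-a-b c+1<next c+1<A[b+1]) n+1<A
    ...     | inj₂ n+1≡A = carry (same-a-b c+1<next c+1<A[b+1]) n+1≡A

  f-suc-> : ∀ c → f c < f (suc c)
  f-suc-> = <-rec (λ c → f c < f (suc c)) step
    where
    step : ∀ c → (∀ {x} → x < c → f x < f (suc x)) → f c < f (suc c)
    step zero    _  = subst (0 <_) (sym (f-Ack 0 0 (Ack-suc-level 0))) (s≤s z≤n)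
    step (suc c) ih = InductionStep.f-suc-> ih (normalForm (suc c) (s≤s z≤n))

mainTheorem6 : (k : ℕ) → 2 ≤ k →
    ((c : ℕ) → c ≤ baseChange k c)
    × ((c d : ℕ) → c < d → baseChange k c < baseChange k d)
mainTheorem6 (suc (suc j)) (s≤s (s≤s z≤n)) =
  step-<⇒≥id f-suc-> , λ _ _ → step-<⇒mono-< f-suc->
  where open BaseChange j
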